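{- Let $k \ge 2$ and let $F$ be a $k$-instance with $m$ clauses and average clause length $\eta$. If $\alpha^*$ is an assignment maximizing the number $s(\alpha^*)$ of satisfied clauses of $F$, then $m \le s(\alpha^*)/\xi$, where $\xi = \frac{2^{k-1}(\eta + k - 2) - \eta + 1}{2^k(k-1)}$. If $F$ contains no $1$-clause and $\alpha^*$ is an assignment maximizing the number $s(\alpha^*)$ of NAE-satisfied clauses of $F$, then $m \le s(\alpha^*)/\xi'$, where $\xi' = \frac{1}{2}$ for $k = 2$ and $\xi' = \frac{2^{k-1}(\eta + k - 4) - 2\eta + 4}{2^k(k-2)}$ for $k \ge 3$.
   Context: Boolean variables $v_1,\dots,v_n$; a literal is $v_i$ or $\bar v_i$; a clause is a nonempty set of literals; an $i$-clause has exactly $i$ literals. A $k$-instance is a finite set of clauses each with at most $k$ literals. A clause is satisfied by an assignment if at least one literal is true, and NAE-satisfied if at least one literal is true and at least one is false. If $m_i$ is the number of $i$-clauses of $F$ and $m = \sum_i m_i$, the average clause length is $\eta = (\sum_{i=1}^k i\, m_i)/m$. -}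

module Defs where

open import Data.Bool using (Bool; true; false; _∧_; _∨_; not; T)
open import Data.Nat as ℕ using (ℕ; zero; suc; _^_)
open import Data.Nat.Properties using (m*n≢0; m^n≢0)
open import Data.Integer using (+_)
open import Data.Rational using (ℚ; _/_; _+_; _-_; _*_)
open import Data.Fin using (Fin)
open import Data.Product using (_×_)
open import Relation.Nullary using (¬_)
open import Relation.Binary.PropositionalEquality using (_≡_)
open import Data.Fin.Subset using (Subset; ∣_∣)
open import Data.Vec using (lookup)
open import Data.List using (List; []; _∷_; map; length; allFin)
open import Data.Bool.ListAction using (any)
open import Data.Nat.ListAction using (sum)
open import Data.List.Relation.Unary.All using (All)
open import Data.List.Relation.Unary.Unique.Propositional using (Unique)

-- A clause over variables v_1..v_n (indexed by Fin n) is a set of literals,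
-- given by the set `pos` of variables occurring positively (v_i) and the set
-- `neg` of variables occurring negatively (v̄_i).  Non-emptiness is imposed
-- in `IsInstance` below.
record Clause (n : ℕ) : Set where
  constructor clause
  field
    pos : Subset n
    neg : Subset n
open Clause public

size : ∀ {n} → Clause n → ℕ
size C = ∣ pos C ∣ ℕ.+ ∣ neg C ∣

Assignment : ℕ → Set
Assignment n = Fin n → Bool

hasTrueLit : ∀ {n} → Assignment n → Clause n → Bool
hasTrueLit {n} α C =
  any (λ i → (lookup (pos C) i ∧ α i) ∨ (lookup (neg C) i ∧ not (α i))) (allFin n)

hasFalseLit : ∀ {n} → Assignment n → Clause n → Bool
hasFalseLit {n} α C =
  any (λ i → (lookup (pos C) i ∧ not (α i)) ∨ (lookup (neg C) i ∧ α i)) (allFin n)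

satisfies : ∀ {n} → Assignment n → Clause n → Bool
satisfies = hasTrueLit

naeSatisfies : ∀ {n} → Assignment n → Clause n → Bool
naeSatisfies α C = hasTrueLit α C ∧ hasFalseLit α C

countTrue : List Bool → ℕ
countTrue [] = 0
countTrue (true ∷ bs) = suc (countTrue bs)
countTrue (false ∷ bs) = countTrue bs

-- A k-instance over n variables: a finite SET of clauses (a duplicate-free
-- list), each clause nonempty and with at most k literals.
IsInstance : ∀ {n} → ℕ → List (Clause n) → Set
IsInstance k F = Unique F × All (λ C → 1 ℕ.≤ size C × size C ℕ.≤ k) F

No1Clause : ∀ {n} → List (Clause n) → Set
No1Clause F = All (λ C → ¬ (size C ≡ 1)) F

sat# : ∀ {n} → Assignment n → List (Clause n) → ℕ
sat# α F = countTrue (map (satisfies α) F)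

nae# : ∀ {n} → Assignment n → List (Clause n) → ℕ
nae# α F = countTrue (map (naeSatisfies α) F)

q : ℕ → ℚ
q n = + n / 1

η : ∀ {n} (F : List (Clause n)) → .{{ℕ.NonZero (length F)}} → ℚ
η F = + sum (map size F) / length F

-- ξ = (2^{k-1}(η + k - 2) - η + 1) / (2^k (k-1)),  for k ≥ 2
-- (value for k < 2 is irrelevant; the theorem assumes k ≥ 2)
ξ : ℕ → ℚ → ℚ
ξ 0 e = q 0
ξ 1 e = q 0
ξ k@(suc (suc j)) e =
  (q (2 ^ (k ℕ.∸ 1)) * (e + q k - q 2) - e + q 1)
  * ((+ 1 / (2 ^ k ℕ.* (k ℕ.∸ 1))) {{m*n≢0 (2 ^ k) (suc j) {{m^n≢0 2 k}}}})

ξ' : ℕ → ℚ → ℚ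
ξ' 0 e = q 0
ξ' 1 e = q 0
ξ' 2 e = + 1 / 2
ξ' k@(suc (suc (suc j))) e =
  (q (2 ^ (k ℕ.∸ 1)) * (e + q k - q 4) - q 2 * e + q 4)
  * ((+ 1 / (2 ^ k ℕ.* (k ℕ.∸ 2))) {{m*n≢0 (2 ^ k) (suc j) {{m^n≢0 2 k}}}})

-- A clause with c literals is falsified by exactly a 2^−c fraction of the 2^n
-- assignments, or by none if it contains a complementary pair; it is NAE-falsified
-- by at most twice that many, namely the falsifiers of C and of C with every literal
-- negated.  Summing over the clauses, the average number of clauses satisfied by an
-- assignment is at least Σ_C (1 − 2^−|C|), and so is the maximum.  On 1 ≤ c ≤ k the
-- concave function c ↦ 1 − 2^−c lies above its chord through c = 1 and c = k, an
-- affine function of c whose average over the clauses is ξ(η).  For NAE a clause of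
-- size c + 1 counts like a SAT clause of size c, and the same chord one size down
-- gives ξ′(η).

module Submission where

open import Defs
open import Data.Bool using (Bool; true; false; _∧_; _∨_; not; if_then_else_)
open import Data.Bool.Properties using (∨-comm; ∨-identityʳ; ∧-zeroʳ; ∧-identityʳ)
open import Data.Nat using (ℕ; zero; suc; _^_; _+_; _*_; _∸_; _≤_; _<_; z≤n; s≤s; NonZero)
open import Data.Nat.Properties
open import Data.Nat.Tactic.RingSolver using (solve-∀)
open import Data.Fin using (Fin; zero; suc)
open import Data.Fin.Subset using (Subset; ∣_∣)
open import Data.Vec using ([]; _∷_; lookup)
open import Data.List using (List; []; _∷_; [_]; map; length; allFin)
open import Data.List.Properties using (map-cong; map-tabulate)
open import Data.List.Relation.Unary.All as All using (All; []; _∷_)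
open import Data.Nat.ListAction using (sum)
open import Data.Bool.ListAction using (any; or)
open import Data.Product using (_×_; _,_; uncurry)
open import Function using (_∘_)
import Data.Integer as ℤ
import Data.Integer.Properties as ℤ
import Data.Nat.Coprimality as C
open import Data.Rational using (_/_)
import Data.Rational as ℚ
import Data.Rational.Properties as ℚ
import Data.Rational.Unnormalised as ℚᵘ
import Data.Rational.Unnormalised.Properties as ℚᵘ
open import Data.Rational.Solver using (module +-*-Solver)
open +-*-Solver using (solve; con; _:+_; _:*_; _:-_; _:=_)
open import Data.Empty using (⊥-elim)
open import Relation.Nullary using (¬_)
open import Relation.Binary.PropositionalEquality
  using (_≡_; refl; sym; trans; cong; cong₂; subst; subst₂; module ≡-Reasoning)

extend : ∀ {n} → Bool → Assignment n → Assignment (suc n)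
extend b α zero = b
extend b α (suc i) = α i

sumAll : ∀ n → (Assignment n → ℕ) → ℕ
sumAll zero f = f (λ ())
sumAll (suc n) f = sumAll n (f ∘ extend false) + sumAll n (f ∘ extend true)

count : ∀ n → (Assignment n → Bool) → ℕ
count n P = sumAll n (λ α → countTrue [ P α ])

sumAll-mono : ∀ n {f g : Assignment n → ℕ} → (∀ α → f α ≤ g α) → sumAll n f ≤ sumAll n g
sumAll-mono zero f≤g = f≤g _
sumAll-mono (suc n) f≤g = +-mono-≤ (sumAll-mono n (f≤g ∘ extend false)) (sumAll-mono n (f≤g ∘ extend true))

sumAll-cong : ∀ n {f g : Assignment n → ℕ} → (∀ α → f α ≡ g α) → sumAll n f ≡ sumAll n g
sumAll-cong n f≡g = ≤-antisym (sumAll-mono n (≤-reflexive ∘ f≡g)) (sumAll-mono n (≤-reflexive ∘ sym ∘ f≡g))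

sumAll-const : ∀ n s → sumAll n (λ _ → s) ≡ 2 ^ n * s
sumAll-const zero s = sym (+-identityʳ s)
sumAll-const (suc n) s =
  trans (cong₂ _+_ (sumAll-const n s) (sumAll-const n s)) (double (2 ^ n) s)
  where
  double : ∀ x s → x * s + x * s ≡ 2 * x * s
  double = solve-∀

sumAll-zero : ∀ n → sumAll n (λ _ → 0) ≡ 0
sumAll-zero n = trans (sumAll-const n 0) (*-zeroʳ (2 ^ n))

sumAll-+ : ∀ n (f g : Assignment n → ℕ) → sumAll n (λ α → f α + g α) ≡ sumAll n f + sumAll n g
sumAll-+ zero f g = refl
sumAll-+ (suc n) f g =
  trans (cong₂ _+_ (sumAll-+ n (f ∘ extend false) (g ∘ extend false)) (sumAll-+ n (f ∘ extend true) (g ∘ extend true)))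
        (+-+-comm (sumAll n (f ∘ extend false)) _ _ _)
  where
  +-+-comm : ∀ a b c d → (a + b) + (c + d) ≡ (a + c) + (b + d)
  +-+-comm = solve-∀

sumAll-sum : ∀ {A : Set} n (g : Assignment n → A → ℕ) (xs : List A) →
  sumAll n (λ α → sum (map (g α) xs)) ≡ sum (map (λ x → sumAll n (λ α → g α x)) xs)
sumAll-sum n g [] = sumAll-zero n
sumAll-sum n g (x ∷ xs) =
  trans (sumAll-+ n (λ α → g α x) (λ α → sum (map (g α) xs))) (cong (sumAll n (λ α → g α x) +_) (sumAll-sum n g xs))

countTrue-map : ∀ {A : Set} (f : A → Bool) (xs : List A) →
  countTrue (map f xs) ≡ sum (map (λ x → countTrue [ f x ]) xs)
countTrue-map f [] = refl
countTrue-map f (x ∷ xs) with f x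
... | true = cong suc (countTrue-map f xs)
... | false = countTrue-map f xs

count-cong : ∀ n {P Q : Assignment n → Bool} → (∀ α → P α ≡ Q α) → count n P ≡ count n Q
count-cong n P≡Q = sumAll-cong n (λ α → cong (λ b → countTrue [ b ]) (P≡Q α))

count-complement : ∀ n (P : Assignment n → Bool) → count n P + count n (not ∘ P) ≡ 2 ^ n
count-complement n P = begin
  count n P + count n (not ∘ P)                           ≡⟨ sumAll-+ n _ _ ⟨
  sumAll n (λ α → countTrue [ P α ] + countTrue [ not (P α) ]) ≡⟨ sumAll-cong n (λ α → one (P α)) ⟩
  sumAll n (λ _ → 1)                                       ≡⟨ sumAll-const n 1 ⟩
  2 ^ n * 1                                                ≡⟨ *-identityʳ (2 ^ n) ⟩
  2 ^ n                                                    ∎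
  where
  open ≡-Reasoning
  one : ∀ b → countTrue [ b ] + countTrue [ not b ] ≡ 1
  one true = refl
  one false = refl

count-∨ : ∀ n (P Q : Assignment n → Bool) → count n (λ α → P α ∨ Q α) ≤ count n P + count n Q
count-∨ n P Q = begin
  count n (λ α → P α ∨ Q α)                                ≤⟨ sumAll-mono n (λ α → subadditive (P α) (Q α)) ⟩
  sumAll n (λ α → countTrue [ P α ] + countTrue [ Q α ])   ≡⟨ sumAll-+ n _ _ ⟩
  count n P + count n Q                                    ∎
  where
  open ≤-Reasoning
  subadditive : ∀ a b → countTrue [ a ∨ b ] ≤ countTrue [ a ] + countTrue [ b ]
  subadditive true b = s≤s z≤n
  subadditive false b = ≤-refl

-- Falsifying assignments of a clause

any-allFin-suc : ∀ {n} (f : Fin (suc n) → Bool) → any f (allFin (suc n)) ≡ f zero ∨ any (f ∘ suc) (allFin n)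
any-allFin-suc {n} f = cong (λ bs → f zero ∨ or bs)
  (trans (map-tabulate suc f) (sym (map-tabulate (λ i → i) (f ∘ suc))))

hasTrueLit-extend : ∀ {n} b (α : Assignment n) p q (ps qs : Subset n) →
  hasTrueLit (extend b α) (clause (p ∷ ps) (q ∷ qs))
    ≡ ((p ∧ b) ∨ (q ∧ not b)) ∨ hasTrueLit α (clause ps qs)
hasTrueLit-extend b α p q ps qs =
  any-allFin-suc (λ i → (lookup (p ∷ ps) i ∧ extend b α i) ∨ (lookup (q ∷ qs) i ∧ not (extend b α i)))

negateLiterals : ∀ {n} → Clause n → Clause n
negateLiterals C = clause (neg C) (pos C)

hasFalseLit≡hasTrueLit-negateLiterals : ∀ {n} (α : Assignment n) C →
  hasFalseLit α C ≡ hasTrueLit α (negateLiterals C)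
hasFalseLit≡hasTrueLit-negateLiterals {n} α C =
  cong or (map-cong (λ i → ∨-comm (lookup (pos C) i ∧ not (α i)) (lookup (neg C) i ∧ α i)) (allFin n))

falsifiers : ∀ {n} → Clause n → ℕ
falsifiers {n} C = count n (λ α → not (hasTrueLit α C))

count-not-∨ : ∀ n ℓ (P : Assignment n → Bool) →
  count n (λ α → not (ℓ ∨ P α)) ≡ (if ℓ then 0 else count n (not ∘ P))
count-not-∨ n true P = sumAll-zero n
count-not-∨ n false P = refl

falsifiers-∷ : ∀ {n} p q (ps qs : Subset n) → let C = clause ps qs in
  falsifiers (clause (p ∷ ps) (q ∷ qs)) ≡ (if q then 0 else falsifiers C) + (if p then 0 else falsifiers C)
falsifiers-∷ {n} p q ps qs = cong₂ _+_ (branch false q (lit-false p q)) (branch true p (lit-true p q))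
  where
  branch : ∀ b ℓ → (p ∧ b) ∨ (q ∧ not b) ≡ ℓ →
    count n (λ α → not (hasTrueLit (extend b α) (clause (p ∷ ps) (q ∷ qs))))
      ≡ (if ℓ then 0 else falsifiers (clause ps qs))
  branch b ℓ refl = trans (count-cong n (λ α → cong not (hasTrueLit-extend b α p q ps qs)))
                          (count-not-∨ n _ (λ α → hasTrueLit α (clause ps qs)))
  lit-false : ∀ p q → (p ∧ false) ∨ (q ∧ true) ≡ q
  lit-false p q = cong₂ _∨_ (∧-zeroʳ p) (∧-identityʳ q)
  lit-true : ∀ p q → (p ∧ true) ∨ (q ∧ false) ≡ p
  lit-true p q = trans (cong₂ _∨_ (∧-identityʳ p) (∧-zeroʳ q)) (∨-identityʳ p)

pair-bound : ∀ a b c z → a * c ≤ z → b * c ≤ z → (a + b) * c ≤ 2 * z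
pair-bound a b c z ac≤z bc≤z = begin
  (a + b) * c   ≡⟨ *-distribʳ-+ c a b ⟩
  a * c + b * c ≤⟨ +-mono-≤ ac≤z (≤-trans bc≤z (m≤m+n z 0)) ⟩
  2 * z         ∎
  where open ≤-Reasoning

falsifiers-bound : ∀ {n} (C : Clause n) → falsifiers C * 2 ^ size C ≤ 2 ^ n
falsifiers-bound {zero} (clause [] []) = ≤-refl
falsifiers-bound {suc n} (clause (p ∷ ps) (q ∷ qs))
  rewrite falsifiers-∷ p q ps qs = step p q (falsifiers-bound (clause ps qs))
  where
  U = falsifiers (clause ps qs)
  N = 2 ^ n
  shift : ∀ x y z → x * y ≤ z → x * (2 * y) ≤ 2 * z
  shift x y z h = subst (_≤ 2 * z) (swap x y) (*-monoʳ-≤ 2 h)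
    where
    swap : ∀ x y → 2 * (x * y) ≡ x * (2 * y)
    swap = solve-∀
  step : ∀ p q → U * 2 ^ size (clause ps qs) ≤ N →
    ((if q then 0 else U) + (if p then 0 else U)) * 2 ^ (∣ p ∷ ps ∣ + ∣ q ∷ qs ∣) ≤ 2 * N
  step false false h = pair-bound U U _ N h h
  step true false h = subst (λ u → u * 2 ^ (suc (∣ ps ∣ + ∣ qs ∣)) ≤ 2 * N) (sym (+-identityʳ U)) (shift U _ N h)
  step false true h = subst (λ e → U * 2 ^ e ≤ 2 * N) (sym (+-suc ∣ ps ∣ ∣ qs ∣)) (shift U _ N h)
  step true true h = z≤n

naeFalsifiers : ∀ {n} → Clause n → ℕ
naeFalsifiers {n} C = count n (λ α → not (naeSatisfies α C))

naeFalsifiers≤falsifiers+falsifiers-negated : ∀ {n} (C : Clause n) →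
  naeFalsifiers C ≤ falsifiers C + falsifiers (negateLiterals C)
naeFalsifiers≤falsifiers+falsifiers-negated {n} C = begin
  naeFalsifiers C
    ≡⟨ count-cong n (λ α → not-∧ (hasTrueLit α C) (hasFalseLit α C)) ⟩
  count n (λ α → not (hasTrueLit α C) ∨ not (hasFalseLit α C))
    ≤⟨ count-∨ n (λ α → not (hasTrueLit α C)) (λ α → not (hasFalseLit α C)) ⟩
  falsifiers C + count n (λ α → not (hasFalseLit α C))
    ≡⟨ cong (falsifiers C +_) (count-cong n (λ α → cong not (hasFalseLit≡hasTrueLit-negateLiterals α C))) ⟩
  falsifiers C + falsifiers (negateLiterals C) ∎
  where
  open ≤-Reasoning
  not-∧ : ∀ a b → not (a ∧ b) ≡ not a ∨ not b
  not-∧ true b = refl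
  not-∧ false b = refl

naeFalsifiers-bound : ∀ {n} (C : Clause n) → naeFalsifiers C * 2 ^ size C ≤ 2 * 2 ^ n
naeFalsifiers-bound {n} C = ≤-trans
  (*-monoˡ-≤ (2 ^ size C) (naeFalsifiers≤falsifiers+falsifiers-negated C))
  (pair-bound (falsifiers C) (falsifiers C̄) (2 ^ size C) (2 ^ n) (falsifiers-bound C)
              (subst (λ c → falsifiers C̄ * 2 ^ c ≤ 2 ^ n) (+-comm ∣ neg C ∣ ∣ pos C ∣) (falsifiers-bound C̄)))
  where
  C̄ = negateLiterals C

naeFalsifiers-halved : ∀ {n} (C : Clause n) c → size C ≡ suc c → naeFalsifiers C * 2 ^ c ≤ 2 ^ n
naeFalsifiers-halved {n} C c size≡ = *-cancelˡ-≤ 2 (subst (_≤ 2 * 2 ^ n) (regroup (naeFalsifiers C) (2 ^ c))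
  (subst (λ e → naeFalsifiers C * 2 ^ e ≤ 2 * 2 ^ n) size≡ (naeFalsifiers-bound C)))
  where
  regroup : ∀ x y → x * (2 * y) ≡ 2 * (x * y)
  regroup = solve-∀

n<2^n : ∀ n → n < 2 ^ n
n<2^n zero = s≤s z≤n
n<2^n (suc n) = +-mono-≤ (m^n>0 2 n) (≤-trans (n<2^n n) (m≤m+n (2 ^ n) 0))

2^n≤n*2^n+1 : ∀ n → 2 ^ n ≤ n * 2 ^ n + 1
2^n≤n*2^n+1 zero = ≤-refl
2^n≤n*2^n+1 (suc n) = ≤-trans (m≤m+n (2 ^ suc n) (n * 2 ^ suc n)) (m≤m+n _ 1)

mixed-power-bound : ∀ a b → 2 ^ b * (a + b) ≤ 2 ^ a * 2 ^ b * b + a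
mixed-power-bound a b = begin
  Y * (a + b)             ≡⟨ expand a b Y ⟩
  a * Y + b * Y           ≤⟨ +-monoˡ-≤ (b * Y) (*-monoʳ-≤ a (2^n≤n*2^n+1 b)) ⟩
  a * (b * Y + 1) + b * Y ≡⟨ regroup a b Y ⟩
  suc a * (b * Y) + a     ≤⟨ +-monoˡ-≤ a (*-monoˡ-≤ (b * Y) (n<2^n a)) ⟩
  X * (b * Y) + a         ≡⟨ cong (_+ a) (reorder X b Y) ⟩
  X * Y * b + a           ∎
  where
  open ≤-Reasoning
  X = 2 ^ a
  Y = 2 ^ b
  expand : ∀ a b Y → Y * (a + b) ≡ a * Y + b * Y
  expand = solve-∀
  regroup : ∀ a b Y → a * (b * Y + 1) + b * Y ≡ suc a * (b * Y) + a
  regroup = solve-∀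
  reorder : ∀ X b Y → X * (b * Y) ≡ X * Y * b
  reorder = solve-∀

-- Concavity of c ↦ 1 − 2^−c on [1, k]:
-- 1 − 2^−c ≥ (2^(k−1) (c + k − 2) − c + 1) / (2^k (k − 1)), denominators cleared,
-- for c = a + 1 and k = a + b + 1.
power-chord : ∀ a b →
  2 ^ suc a * (2 ^ (a + b) * (a + (a + b)) + 1) + 2 * 2 ^ (a + b) * (a + b)
    ≤ 2 ^ suc a * (2 * 2 ^ (a + b) * (a + b)) + 2 ^ suc a * suc a
power-chord a b = subst
  (λ Z → 2 * X * (Z * (a + (a + b)) + 1) + 2 * Z * (a + b) ≤ 2 * X * (2 * Z * (a + b)) + 2 * X * suc a)
  (sym (^-distribˡ-+-* 2 a b))
  (begin
    2 * X * (X * Y * (a + (a + b)) + 1) + 2 * (X * Y) * (a + b)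
      ≡⟨ split-off a b X Y ⟩
    2 * X * (X * Y * (a + b)) + 2 * X * (X * Y * a + 1 + Y * (a + b))
      ≤⟨ +-monoʳ-≤ _ (*-monoʳ-≤ (2 * X) (+-monoʳ-≤ (X * Y * a + 1) (mixed-power-bound a b))) ⟩
    2 * X * (X * Y * (a + b)) + 2 * X * (X * Y * a + 1 + (X * Y * b + a))
      ≡⟨ merge a b X Y ⟩
    2 * X * (2 * (X * Y) * (a + b)) + 2 * X * suc a ∎)
  where
  open ≤-Reasoning
  X = 2 ^ a
  Y = 2 ^ b
  split-off : ∀ a b X Y → 2 * X * (X * Y * (a + (a + b)) + 1) + 2 * (X * Y) * (a + b)
    ≡ 2 * X * (X * Y * (a + b)) + 2 * X * (X * Y * a + 1 + Y * (a + b))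
  split-off = solve-∀
  merge : ∀ a b X Y → 2 * X * (X * Y * (a + b)) + 2 * X * (X * Y * a + 1 + (X * Y * b + a))
    ≡ 2 * X * (2 * (X * Y) * (a + b)) + 2 * X * suc a
  merge = solve-∀

sat-chord : ∀ j c → 1 ≤ c → c ≤ 2 + j →
  2 ^ c * (2 ^ suc j * (c + j) + 1) + 2 ^ (2 + j) * suc j ≤ 2 ^ c * (2 ^ (2 + j) * suc j) + 2 ^ c * c
sat-chord j (suc a) _ (s≤s a≤1+j) =
  subst (chord (suc j)) (+-suc a j) (subst (λ K → chord K (a + K)) (m+[n∸m]≡n a≤1+j) (power-chord a (suc j ∸ a)))
  where
  chord : ℕ → ℕ → Set
  chord K m = 2 ^ suc a * (2 ^ K * m + 1) + 2 * 2 ^ K * K ≤ 2 ^ suc a * (2 * 2 ^ K * K) + 2 ^ suc a * suc a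

nae-chord : ∀ j c → 1 ≤ c → c ≤ 2 + j →
  2 ^ c * (2 ^ (2 + j) * (suc c + j) + 4) + 2 ^ (3 + j) * suc j
    ≤ 2 ^ c * (2 ^ (3 + j) * suc j) + 2 ^ c * (2 * suc c + 2 ^ (2 + j))
nae-chord j c 1≤c c≤2+j = begin
  X * (2 * P * (suc c + j) + 4) + 2 * (2 * P) * suc j   ≡⟨ double-sat c j X P ⟩
  2 * (X * (P * (c + j) + 1) + 2 * P * suc j) + X * (2 * P + 2)
    ≤⟨ +-monoˡ-≤ (X * (2 * P + 2)) (*-monoʳ-≤ 2 (sat-chord j c 1≤c c≤2+j)) ⟩
  2 * (X * (2 * P * suc j) + X * c) + X * (2 * P + 2)   ≡⟨ double-sat′ c j X P ⟩
  X * (2 * (2 * P) * suc j) + X * (2 * suc c + 2 * P)   ∎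
  where
  open ≤-Reasoning
  X = 2 ^ c
  P = 2 ^ suc j
  double-sat : ∀ c j X P → X * (2 * P * (suc c + j) + 4) + 2 * (2 * P) * suc j
    ≡ 2 * (X * (P * (c + j) + 1) + 2 * P * suc j) + X * (2 * P + 2)
  double-sat = solve-∀
  double-sat′ : ∀ c j X P → 2 * (X * (2 * P * suc j) + X * c) + X * (2 * P + 2)
    ≡ X * (2 * (2 * P) * suc j) + X * (2 * suc c + 2 * P)
  double-sat′ = solve-∀

-- The hypotheses say T/N ≥ 1 − 1/p and L ≤ D (1 − 1/p) + R.
scaled-bound : ∀ {N T U p} .{{_ : NonZero p}} L D R → T + U ≡ N → U * p ≤ N →
  p * L + D ≤ p * D + p * R → N * L ≤ D * T + N * R
scaled-bound {N} {T} {U} {p} L D R refl Up≤N chord = *-cancelˡ-≤ p (+-cancelʳ-≤ (N * D) _ _ (begin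
  p * (N * L) + N * D              ≡⟨ factor p N L D ⟩
  N * (p * L + D)                  ≤⟨ *-monoʳ-≤ N chord ⟩
  N * (p * D + p * R)              ≡⟨ split p T U D R ⟩
  p * (D * T + N * R) + U * p * D  ≤⟨ +-monoʳ-≤ (p * (D * T + N * R)) (*-monoˡ-≤ D Up≤N) ⟩
  p * (D * T + N * R) + N * D      ∎))
  where
  open ≤-Reasoning
  factor : ∀ p N L D → p * (N * L) + N * D ≡ N * (p * L + D)
  factor = solve-∀
  split : ∀ p T U D R → (T + U) * (p * D + p * R) ≡ p * (D * T + (T + U) * R) + U * p * D
  split = solve-∀

sat-clause-bound : ∀ {n} j (C : Clause n) → 1 ≤ size C × size C ≤ 2 + j →
  2 ^ n * (2 ^ suc j * size C + (2 ^ suc j * j + 1))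
    ≤ 2 ^ (2 + j) * suc j * count n (λ α → satisfies α C) + 2 ^ n * (1 * size C + 0)
sat-clause-bound {n} j C (1≤c , c≤2+j) =
  subst₂ (λ L R → 2 ^ n * L ≤ 2 ^ (2 + j) * suc j * count n (λ α → satisfies α C) + 2 ^ n * R)
    (distribute (2 ^ suc j) (size C) j) (unit (size C))
    (scaled-bound {{m^n≢0 2 (size C)}} _ _ _
      (count-complement n (λ α → satisfies α C)) (falsifiers-bound C) (sat-chord j (size C) 1≤c c≤2+j))
  where
  distribute : ∀ P c j → P * (c + j) + 1 ≡ P * c + (P * j + 1)
  distribute = solve-∀
  unit : ∀ c → c ≡ 1 * c + 0
  unit = solve-∀

nae-clause-bound : ∀ {n} j (C : Clause n) → 1 ≤ size C × size C ≤ 3 + j → ¬ size C ≡ 1 →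
  2 ^ n * (2 ^ (2 + j) * size C + (2 ^ (2 + j) * j + 4))
    ≤ 2 ^ (3 + j) * suc j * count n (λ α → naeSatisfies α C) + 2 ^ n * (2 * size C + 2 ^ (2 + j))
nae-clause-bound {n} j C (_ , c≤3+j) c≢1 with size C in size≡
... | suc zero = ⊥-elim (c≢1 refl)
... | suc c@(suc _) =
  subst (λ L → 2 ^ n * L ≤ 2 ^ (3 + j) * suc j * count n (λ α → naeSatisfies α C) + 2 ^ n * (2 * suc c + 2 ^ (2 + j)))
    (distribute (2 ^ (2 + j)) c j)
    (scaled-bound {{m^n≢0 2 c}} _ _ _
      (count-complement n (λ α → naeSatisfies α C)) (naeFalsifiers-halved C c size≡)
      (nae-chord j c (s≤s z≤n) (≤-pred c≤3+j)))
  where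
  distribute : ∀ P c j → P * (suc c + j) + 4 ≡ P * suc c + (P * j + 4)
  distribute = solve-∀

nae-clause-bound₂ : ∀ {n} (C : Clause n) → 1 ≤ size C × size C ≤ 2 → ¬ size C ≡ 1 →
  2 ^ n * (0 * size C + 1) ≤ 2 * count n (λ α → naeSatisfies α C) + 2 ^ n * (0 * size C + 0)
nae-clause-bound₂ {n} C (_ , c≤2) c≢1 with size C in size≡ | c≤2
... | suc zero | _ = ⊥-elim (c≢1 refl)
... | suc (suc zero) | _ =
  scaled-bound {T = count n (λ α → naeSatisfies α C)} {p = 2 ^ 1} 1 2 0
    (count-complement n (λ α → naeSatisfies α C)) (naeFalsifiers-halved C 1 size≡) ≤-refl
... | suc (suc (suc _)) | s≤s (s≤s ())

-- Averaging over the clauses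

sum-bound : ∀ {A : Set} N D (L T R : A → ℕ) {xs} → All (λ x → N * L x ≤ D * T x + N * R x) xs →
  N * sum (map L xs) ≤ D * sum (map T xs) + N * sum (map R xs)
sum-bound N D L T R [] = ≤-reflexive (empty N D)
  where
  empty : ∀ N D → N * 0 ≡ D * 0 + N * 0
  empty = solve-∀
sum-bound N D L T R {x ∷ xs} (h ∷ hs) = begin
  N * (L x + sum (map L xs))                                       ≡⟨ *-distribˡ-+ N (L x) _ ⟩
  N * L x + N * sum (map L xs)                                     ≤⟨ +-mono-≤ h (sum-bound N D L T R hs) ⟩
  (D * T x + N * R x) + (D * sum (map T xs) + N * sum (map R xs))  ≡⟨ regroup N D (T x) (R x) _ _ ⟩
  D * (T x + sum (map T xs)) + N * (R x + sum (map R xs))          ∎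
  where
  open ≤-Reasoning
  regroup : ∀ N D t r T R → (D * t + N * r) + (D * T + N * R) ≡ D * (t + T) + N * (r + R)
  regroup = solve-∀

sum-map-affine : ∀ {A : Set} a b (f : A → ℕ) xs →
  sum (map (λ x → a * f x + b) xs) ≡ a * sum (map f xs) + b * length xs
sum-map-affine a b f [] = sym (cong₂ _+_ (*-zeroʳ a) (*-zeroʳ b))
sum-map-affine a b f (x ∷ xs) =
  trans (cong (a * f x + b +_) (sum-map-affine a b f xs)) (regroup a b (f x) _ (length xs))
  where
  regroup : ∀ a b y S m → a * y + b + (a * S + b * m) ≡ a * (y + S) + b * suc m
  regroup = solve-∀

double-count-bound : ∀ {A : Set} n (holds : Assignment n → A → Bool) xs s →
  (∀ α → countTrue (map (holds α) xs) ≤ s) →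
  sum (map (λ x → count n (λ α → holds α x)) xs) ≤ 2 ^ n * s
double-count-bound n holds xs s bounded = begin
  sum (map (λ x → count n (λ α → holds α x)) xs)         ≡⟨ sumAll-sum n (λ α x → countTrue [ holds α x ]) xs ⟨
  sumAll n (λ α → sum (map (λ x → countTrue [ holds α x ]) xs)) ≡⟨ sumAll-cong n (λ α → countTrue-map (holds α) xs) ⟨
  sumAll n (λ α → countTrue (map (holds α) xs))          ≤⟨ sumAll-mono n bounded ⟩
  sumAll n (λ _ → s)                                     ≡⟨ sumAll-const n s ⟩
  2 ^ n * s                                              ∎
  where open ≤-Reasoning

averaged-bound : ∀ {A : Set} n (holds : Assignment n → A → Bool) (f : A → ℕ) xs a b D d e s →
  All (λ x → 2 ^ n * (a * f x + b) ≤ D * count n (λ α → holds α x) + 2 ^ n * (d * f x + e)) xs →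
  (∀ α → countTrue (map (holds α) xs) ≤ s) →
  a * sum (map f xs) + b * length xs ≤ D * s + (d * sum (map f xs) + e * length xs)
averaged-bound n holds f xs a b D d e s clause-bounds bounded = *-cancelˡ-≤ N {{m^n≢0 2 n}} (begin
  N * (a * S + b * m)                                    ≡⟨ cong (N *_) (sum-map-affine a b f xs) ⟨
  N * sum (map (λ x → a * f x + b) xs)                   ≤⟨ sum-bound N D _ _ _ clause-bounds ⟩
  D * sum (map (λ x → count n (λ α → holds α x)) xs) + N * sum (map (λ x → d * f x + e) xs)
    ≤⟨ +-mono-≤ (*-monoʳ-≤ D (double-count-bound n holds xs s bounded))
                (≤-reflexive (cong (N *_) (sum-map-affine d e f xs))) ⟩
  D * (N * s) + N * (d * S + e * m)                      ≡⟨ regroup N D s (d * S + e * m) ⟩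
  N * (D * s + (d * S + e * m))                          ∎)
  where
  open ≤-Reasoning
  N = 2 ^ n
  S = sum (map f xs)
  m = length xs
  regroup : ∀ N D s X → D * (N * s) + N * X ≡ N * (D * s + X)
  regroup = solve-∀

-- Passing to ℚ

q≡mkℚ : ∀ n → q n ≡ ℚ.mkℚ (ℤ.+ n) 0 (C.sym (C.1-coprimeTo n))
q≡mkℚ n = ℚ.normalize-coprime (C.sym (C.1-coprimeTo n))

q-+ : ∀ a b → q (a + b) ≡ q a ℚ.+ q b
q-+ a b = trans (ℚ./-cong {ℤ.+ (a + b)} {1} eq refl) (sym (cong₂ ℚ._+_ (q≡mkℚ a) (q≡mkℚ b)))
  where
  eq : ℤ.+ (a + b) ≡ ℤ.+ a ℤ.* ℤ.+ 1 ℤ.+ ℤ.+ b ℤ.* ℤ.+ 1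
  eq = trans (ℤ.pos-+ a b) (sym (cong₂ ℤ._+_ (ℤ.*-identityʳ (ℤ.+ a)) (ℤ.*-identityʳ (ℤ.+ b))))

q-* : ∀ a b → q (a * b) ≡ q a ℚ.* q b
q-* a b = trans (ℚ./-cong {ℤ.+ (a * b)} {1} (ℤ.pos-* a b) refl) (sym (cong₂ ℚ._*_ (q≡mkℚ a) (q≡mkℚ b)))

q-mono-≤ : ∀ {a b} → a ≤ b → q a ℚ.≤ q b
q-mono-≤ {a} {b} a≤b rewrite q≡mkℚ a | q≡mkℚ b =
  ℚ.*≤* (subst₂ ℤ._≤_ (sym (ℤ.*-identityʳ (ℤ.+ a))) (sym (ℤ.*-identityʳ (ℤ.+ b))) (ℤ.+≤+ a≤b))

q*1/q : ∀ D .{{_ : NonZero D}} → q D ℚ.* (ℤ.+ 1 / D) ≡ ℚ.1ℚ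
q*1/q (suc D) = trans (cong₂ ℚ._*_ (q≡mkℚ (suc D)) (ℚ.normalize-coprime (C.1-coprimeTo (suc D))))
                      (ℚ.*-inverseʳ (ℚ.mkℚ (ℤ.+ suc D) 0 (C.sym (C.1-coprimeTo (suc D)))))

q*average : ∀ m S .{{_ : NonZero m}} → q m ℚ.* (ℤ.+ S / m) ≡ q S
q*average (suc m) S = ℚ.toℚᵘ-injective (ℚᵘ.≃-trans (ℚ.toℚᵘ-homo-* (q (suc m)) (ℤ.+ S / suc m))
  (ℚᵘ.≃-trans (ℚᵘ.*-cong (ℚᵘ.≃-reflexive (cong ℚ.toℚᵘ (q≡mkℚ (suc m)))) (ℚ.toℚᵘ-fromℚᵘ (ℚᵘ.mkℚᵘ (ℤ.+ S) m)))
  (ℚᵘ.≃-trans (ℚᵘ.*≡* eq) (ℚᵘ.≃-reflexive (sym (cong ℚ.toℚᵘ (q≡mkℚ S)))))))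
  where
  eq : (ℤ.+ suc m ℤ.* ℤ.+ S) ℤ.* ℤ.+ 1 ≡ ℤ.+ S ℤ.* ℤ.+ suc (m + 0)
  eq = trans (ℤ.*-identityʳ _)
             (trans (ℤ.*-comm (ℤ.+ suc m) (ℤ.+ S)) (cong (λ z → ℤ.+ S ℤ.* ℤ.+ suc z) (sym (+-identityʳ m))))

affineRatio : (a b D d e : ℕ) .{{_ : NonZero D}} → ℚ.ℚ → ℚ.ℚ
affineRatio a b D d e E = (q a ℚ.* E ℚ.+ q b ℚ.- (q d ℚ.* E ℚ.+ q e)) ℚ.* (ℤ.+ 1 / D)

affineRatio-bound : ∀ a b D d e m S s .{{_ : NonZero D}} .{{_ : NonZero m}} →
  a * S + b * m ≤ D * s + (d * S + e * m) →
  q m ℚ.* affineRatio a b D d e (ℤ.+ S / m) ℚ.≤ q s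
affineRatio-bound a b D d e m S s bound = begin
  q m ℚ.* ((q a ℚ.* E ℚ.+ q b ℚ.- (q d ℚ.* E ℚ.+ q e)) ℚ.* h)
    ≡⟨ distribute (q m) (q a) (q b) (q d) (q e) E h ⟩
  (q a ℚ.* (q m ℚ.* E) ℚ.+ q b ℚ.* q m ℚ.- (q d ℚ.* (q m ℚ.* E) ℚ.+ q e ℚ.* q m)) ℚ.* h
    ≡⟨ cong (λ x → (q a ℚ.* x ℚ.+ q b ℚ.* q m ℚ.- (q d ℚ.* x ℚ.+ q e ℚ.* q m)) ℚ.* h) (q*average m S) ⟩
  (q a ℚ.* q S ℚ.+ q b ℚ.* q m ℚ.- (q d ℚ.* q S ℚ.+ q e ℚ.* q m)) ℚ.* h
    ≡⟨ cong₂ (λ x y → (x ℚ.- y) ℚ.* h) (q-affine a b S m) (q-affine d e S m) ⟨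
  (q (a * S + b * m) ℚ.- q (d * S + e * m)) ℚ.* h
    ≤⟨ ℚ.*-monoʳ-≤-nonNeg h {{ℚ.normalize-nonNeg 1 D}} (ℚ.+-monoˡ-≤ (ℚ.- q (d * S + e * m)) (q-mono-≤ bound)) ⟩
  (q (D * s + (d * S + e * m)) ℚ.- q (d * S + e * m)) ℚ.* h
    ≡⟨ cong (λ x → (x ℚ.- q (d * S + e * m)) ℚ.* h) (trans (q-+ (D * s) _) (cong (ℚ._+ q (d * S + e * m)) (q-* D s))) ⟩
  (q D ℚ.* q s ℚ.+ q (d * S + e * m) ℚ.- q (d * S + e * m)) ℚ.* h
    ≡⟨ cancel (q D) (q s) (q (d * S + e * m)) h ⟩
  q s ℚ.* (q D ℚ.* h)
    ≡⟨ cong (q s ℚ.*_) (q*1/q D) ⟩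
  q s ℚ.* ℚ.1ℚ
    ≡⟨ ℚ.*-identityʳ (q s) ⟩
  q s ∎
  where
  open ℚ.≤-Reasoning
  E = ℤ.+ S / m
  h = ℤ.+ 1 / D
  q-affine : ∀ a b S m → q (a * S + b * m) ≡ q a ℚ.* q S ℚ.+ q b ℚ.* q m
  q-affine a b S m = trans (q-+ (a * S) (b * m)) (cong₂ ℚ._+_ (q-* a S) (q-* b m))
  distribute : ∀ M A B Δ ε E h → M ℚ.* ((A ℚ.* E ℚ.+ B ℚ.- (Δ ℚ.* E ℚ.+ ε)) ℚ.* h)
    ≡ (A ℚ.* (M ℚ.* E) ℚ.+ B ℚ.* M ℚ.- (Δ ℚ.* (M ℚ.* E) ℚ.+ ε ℚ.* M)) ℚ.* h
  distribute = solve 7 (λ M A B Δ ε E h → M :* ((A :* E :+ B :- (Δ :* E :+ ε)) :* h)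
    := (A :* (M :* E) :+ B :* M :- (Δ :* (M :* E) :+ ε :* M)) :* h) refl
  cancel : ∀ X Y Z h → (X ℚ.* Y ℚ.+ Z ℚ.- Z) ℚ.* h ≡ Y ℚ.* (X ℚ.* h)
  cancel = solve 4 (λ X Y Z h → (X :* Y :+ Z :- Z) :* h := Y :* (X :* h)) refl

2^k*suc≢0 : ∀ k j → NonZero (2 ^ k * suc j)
2^k*suc≢0 k j = m*n≢0 (2 ^ k) (suc j) {{m^n≢0 2 k}}

ξ-affine : ∀ j E →
  ξ (2 + j) E ≡ affineRatio (2 ^ suc j) (2 ^ suc j * j + 1) (2 ^ (2 + j) * suc j) 1 0 {{2^k*suc≢0 (2 + j) j}} E
ξ-affine j E = begin
  (q P ℚ.* (E ℚ.+ q (2 + j) ℚ.- q 2) ℚ.- E ℚ.+ q 1) ℚ.* h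
    ≡⟨ cong (λ x → (q P ℚ.* (E ℚ.+ x ℚ.- q 2) ℚ.- E ℚ.+ q 1) ℚ.* h) (q-+ 2 j) ⟩
  (q P ℚ.* (E ℚ.+ (q 2 ℚ.+ q j) ℚ.- q 2) ℚ.- E ℚ.+ q 1) ℚ.* h
    ≡⟨ rearrange (q P) E (q j) h ⟩
  (q P ℚ.* E ℚ.+ (q P ℚ.* q j ℚ.+ q 1) ℚ.- (q 1 ℚ.* E ℚ.+ q 0)) ℚ.* h
    ≡⟨ cong (λ x → (q P ℚ.* E ℚ.+ x ℚ.- (q 1 ℚ.* E ℚ.+ q 0)) ℚ.* h) (trans (q-+ (P * j) 1) (cong (ℚ._+ q 1) (q-* P j))) ⟨
  (q P ℚ.* E ℚ.+ q (P * j + 1) ℚ.- (q 1 ℚ.* E ℚ.+ q 0)) ℚ.* h ∎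
  where
  open ≡-Reasoning
  P = 2 ^ suc j
  h = (ℤ.+ 1 / (2 ^ (2 + j) * suc j)) {{2^k*suc≢0 (2 + j) j}}
  rearrange : ∀ P E J h → (P ℚ.* (E ℚ.+ (q 2 ℚ.+ J) ℚ.- q 2) ℚ.- E ℚ.+ q 1) ℚ.* h
    ≡ (P ℚ.* E ℚ.+ (P ℚ.* J ℚ.+ q 1) ℚ.- (q 1 ℚ.* E ℚ.+ q 0)) ℚ.* h
  rearrange = solve 4 (λ P E J h → (P :* (E :+ (con (q 2) :+ J) :- con (q 2)) :- E :+ con (q 1)) :* h
    := (P :* E :+ (P :* J :+ con (q 1)) :- (con (q 1) :* E :+ con (q 0))) :* h) refl

ξ′-affine : ∀ j E →
  ξ' (3 + j) E
    ≡ affineRatio (2 ^ (2 + j)) (2 ^ (2 + j) * j + 4) (2 ^ (3 + j) * suc j) 2 (2 ^ (2 + j)) {{2^k*suc≢0 (3 + j) j}} E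
ξ′-affine j E = begin
  (q P ℚ.* (E ℚ.+ q (3 + j) ℚ.- q 4) ℚ.- q 2 ℚ.* E ℚ.+ q 4) ℚ.* h
    ≡⟨ cong (λ x → (q P ℚ.* (E ℚ.+ x ℚ.- q 4) ℚ.- q 2 ℚ.* E ℚ.+ q 4) ℚ.* h) (q-+ 3 j) ⟩
  (q P ℚ.* (E ℚ.+ (q 3 ℚ.+ q j) ℚ.- q 4) ℚ.- q 2 ℚ.* E ℚ.+ q 4) ℚ.* h
    ≡⟨ rearrange (q P) E (q j) h ⟩
  (q P ℚ.* E ℚ.+ (q P ℚ.* q j ℚ.+ q 4) ℚ.- (q 2 ℚ.* E ℚ.+ q P)) ℚ.* h
    ≡⟨ cong (λ x → (q P ℚ.* E ℚ.+ x ℚ.- (q 2 ℚ.* E ℚ.+ q P)) ℚ.* h) (trans (q-+ (P * j) 4) (cong (ℚ._+ q 4) (q-* P j))) ⟨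
  (q P ℚ.* E ℚ.+ q (P * j + 4) ℚ.- (q 2 ℚ.* E ℚ.+ q P)) ℚ.* h ∎
  where
  open ≡-Reasoning
  P = 2 ^ (2 + j)
  h = (ℤ.+ 1 / (2 ^ (3 + j) * suc j)) {{2^k*suc≢0 (3 + j) j}}
  rearrange : ∀ P E J h → (P ℚ.* (E ℚ.+ (q 3 ℚ.+ J) ℚ.- q 4) ℚ.- q 2 ℚ.* E ℚ.+ q 4) ℚ.* h
    ≡ (P ℚ.* E ℚ.+ (P ℚ.* J ℚ.+ q 4) ℚ.- (q 2 ℚ.* E ℚ.+ P)) ℚ.* h
  rearrange = solve 4 (λ P E J h → (P :* (E :+ (con (q 3) :+ J) :- con (q 4)) :- con (q 2) :* E :+ con (q 4)) :* h
    := (P :* E :+ (P :* J :+ con (q 4)) :- (con (q 2) :* E :+ P)) :* h) refl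

ξ′-two : ∀ E → ξ' 2 E ≡ affineRatio 0 1 2 0 0 E
ξ′-two = solve 1 (λ E → con (ℤ.+ 1 / 2)
  := (con (q 0) :* E :+ con (q 1) :- (con (q 0) :* E :+ con (q 0))) :* con (ℤ.+ 1 / 2)) refl

sat-average-bound : ∀ j n (F : List (Clause n)) → All (λ C → 1 ≤ size C × size C ≤ 2 + j) F →
  .{{_ : NonZero (length F)}} → (s : ℕ) → (∀ β → sat# β F ≤ s) →
  q (length F) ℚ.* ξ (2 + j) (η F) ℚ.≤ q s
sat-average-bound j n F sizes s bounded =
  subst (λ x → q (length F) ℚ.* x ℚ.≤ q s) (sym (ξ-affine j (η F)))
    (affineRatio-bound P (P * j + 1) D 1 0 (length F) (sum (map size F)) s {{2^k*suc≢0 (2 + j) j}}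
      (averaged-bound n satisfies size F P (P * j + 1) D 1 0 s
        (All.map (λ {C} → sat-clause-bound j C) sizes) bounded))
  where
  P = 2 ^ suc j
  D = 2 ^ (2 + j) * suc j

nae-average-bound : ∀ j n (F : List (Clause n)) → All (λ C → 1 ≤ size C × size C ≤ 2 + j) F →
  .{{_ : NonZero (length F)}} → No1Clause F → (s : ℕ) → (∀ β → nae# β F ≤ s) →
  q (length F) ℚ.* ξ' (2 + j) (η F) ℚ.≤ q s
nae-average-bound zero n F sizes no1 s bounded =
  subst (λ x → q (length F) ℚ.* x ℚ.≤ q s) (sym (ξ′-two (η F)))
    (affineRatio-bound 0 1 2 0 0 (length F) (sum (map size F)) s
      (averaged-bound n naeSatisfies size F 0 1 2 0 0 s
        (All.zipWith (λ {C} → uncurry (nae-clause-bound₂ C)) (sizes , no1)) bounded))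
nae-average-bound (suc j) n F sizes no1 s bounded =
  subst (λ x → q (length F) ℚ.* x ℚ.≤ q s) (sym (ξ′-affine j (η F)))
    (affineRatio-bound P (P * j + 4) D 2 P (length F) (sum (map size F)) s {{2^k*suc≢0 (3 + j) j}}
      (averaged-bound n naeSatisfies size F P (P * j + 4) D 2 P s
        (All.zipWith (λ {C} → uncurry (nae-clause-bound j C)) (sizes , no1)) bounded))
  where
  P = 2 ^ (2 + j)
  D = 2 ^ (3 + j) * suc j

lemma5p2 : (k : ℕ) → 2 ≤ k → (n : ℕ) (F : List (Clause n)) → IsInstance k F
    → .{{_ : NonZero (length F)}}
    → ((α* : Assignment n) → ((β : Assignment n) → sat# β F ≤ sat# α* F)
    → q (length F) ℚ.* ξ k (η F) ℚ.≤ q (sat# α* F))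
    × (No1Clause F → (α* : Assignment n) → ((β : Assignment n) → nae# β F ≤ nae# α* F)
    → q (length F) ℚ.* ξ' k (η F) ℚ.≤ q (nae# α* F))
lemma5p2 (suc (suc j)) (s≤s (s≤s z≤n)) n F (_ , sizes) =
  (λ α* → sat-average-bound j n F sizes (sat# α* F)) ,
  (λ no1 α* → nae-average-bound j n F sizes no1 (nae# α* F))
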